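{- Let $n\in\mathbb{N}$ and suppose $n=2^{\alpha_1}-2^{\alpha_2}+\cdots+(-1)^{\ell-1}2^{\alpha_\ell}$ is an alternating binary representation (ABR) of $n$. Then $\alpha_1=\lceil\lg n\rceil$ and, for each $i\in\{2,\ldots,\ell\}$, \[ \alpha_i=\left\lceil \lg\!\left((-1)^{i-1}\Big(n+\sum_{j=1}^{i-1}(-1)^j2^{\alpha_j}\Big)\right)\right\rceil . \] In particular, the ABR of $n$ is unique, and if $\ell\ge 2$ then $(\alpha_2,\ldots,\alpha_\ell)$ determines the ABR of $2^{\alpha_1}-n$, i.e. $2^{\alpha_1}-n=2^{\alpha_2}-2^{\alpha_3}+\cdots+(-1)^{\ell}2^{\alpha_\ell}$ is an ABR.
   Context: $\lg$ denotes the base-2 logarithm. An alternating binary representation (ABR) of $n\in\mathbb{N}$ is an expression $n=2^{\alpha_1}-2^{\alpha_2}+\cdots+(-1)^{\ell-1}2^{\alpha_\ell}$ with $\ell\ge1$ and nonnegative integers $\alpha_1>\alpha_2>\cdots>\alpha_{\ell-1}>\alpha_\ell+1$ (for $\ell=1$ there is no condition on $\alpha_1$); the sequence $(\alpha_1,\ldots,\alpha_\ell)$ is said to determine the ABR. -}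

module Defs where

open import Data.Nat using (ℕ; zero; suc; _<_; _+_; _^_)
open import Data.Integer as ℤ using (ℤ; +_; -_; 0ℤ; 1ℤ)
open import Data.List using (List; []; _∷_)
open import Data.Product using (_×_)
open import Relation.Binary.PropositionalEquality using (_≡_)

altSum : List ℕ → ℤ
altSum []       = 0ℤ
altSum (a ∷ as) = (+ (2 ^ a)) ℤ.- altSum as

-- Exponent conditions of an ABR: ℓ ≥ 1 and
-- α₁ > α₂ > ⋯ > α_{ℓ-1} > α_ℓ + 1 (no condition when ℓ = 1).
data ABRShape : List ℕ → Set where
  one  : ∀ a → ABRShape (a ∷ [])
  two  : ∀ a b → suc b < a → ABRShape (a ∷ b ∷ [])
  more : ∀ a b c rest → b < a → ABRShape (b ∷ c ∷ rest) → ABRShape (a ∷ b ∷ c ∷ rest)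

IsABR : ℕ → List ℕ → Set
IsABR n α = ABRShape α × altSum α ≡ + n

sgn : ℕ → ℤ
sgn k = (- 1ℤ) ℤ.^ k

-- sumFrom j m α = Σ_{t=0}^{m-1} (-1)^(j+t) 2^(α_{t+1})  (truncated at the end of α).
-- In particular  sumFrom 1 (i-1) α = Σ_{j=1}^{i-1} (-1)^j 2^{α_j}  for i ≤ ℓ.
sumFrom : ℕ → ℕ → List ℕ → ℤ
sumFrom j zero    _        = 0ℤ
sumFrom j (suc m) []       = 0ℤ
sumFrom j (suc m) (a ∷ as) = (sgn j ℤ.* (+ (2 ^ a))) ℤ.+ sumFrom (suc j) m as

-- A tail 2^{α_i} − 2^{α_{i+1}} + ⋯ of an ABR has a value v in (2^{α_i − 1}, 2^{α_i}), or
-- v = 2^{α_i} if it is the last term alone: inductively the following tail lies in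
-- (0, 2^{α_{i+1}}] ⊆ (0, 2^{α_i − 1}), using α_{ℓ−1} ≥ α_ℓ + 2 at the end. Hence α_i = ⌈lg v⌉,
-- and v is (−1)^{i−1} (n + Σ_{j<i} (−1)^j 2^{α_j}). Uniqueness follows by induction: the
-- leading exponent is ⌈lg n⌉, the two representations are both single terms or both longer
-- (v = 2^{α_1} versus v < 2^{α_1}), and the tails are ABRs of the same number 2^{α_1} − n.
module Submission where

open import Defs
open import Data.Nat using (ℕ; _≤_; _<_; _^_)
open import Data.Nat.Logarithm using (⌈log₂_⌉)
open import Data.Integer as ℤ using (ℤ; +_)
open import Data.List using (List; []; _∷_; length; lookup; head)
open import Data.Maybe using (just)
open import Data.Fin using (Fin; toℕ)
open import Data.Product using (Σ-syntax; _×_)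
open import Relation.Binary.PropositionalEquality using (_≡_; _≢_)

open import Data.Nat using (zero; suc; _+_; _∸_; z≤n; s≤s; s≤s⁻¹; ⌊_/2⌋; ⌈_/2⌉)
import Data.Nat.Properties as ℕ
open import Data.Nat.Logarithm using (⌈log₂⌉-mono-≤; ⌈log₂⌈n/2⌉⌉≡⌈log₂n⌉∸1; ⌈log₂2^n⌉≡n)
import Data.Integer.Properties as ℤ
open import Data.Integer.Tactic.RingSolver using (solve-∀)
open import Data.List using (drop)
open import Data.Fin using (zero; suc)
open import Data.Product using (_,_; proj₁; proj₂)
open import Data.Empty using (⊥; ⊥-elim)
open import Relation.Binary.PropositionalEquality
  using (refl; sym; trans; cong; subst; module ≡-Reasoning)

2^[1+k]≡2^k+2^k : ∀ k → 2 ^ suc k ≡ 2 ^ k + 2 ^ k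
2^[1+k]≡2^k+2^k k = cong (λ m → 2 ^ k + m) (ℕ.+-identityʳ (2 ^ k))

2^k<n⇒k<⌈log₂n⌉ : ∀ k {n} → 2 ^ k < n → k < ⌈log₂ n ⌉
2^k<n⇒k<⌈log₂n⌉ zero    1<n = ⌈log₂⌉-mono-≤ 1<n
2^k<n⇒k<⌈log₂n⌉ (suc k) {suc w} 2^[1+k]<1+w = <∸1⇒suc< (subst (k <_) halving k<⌈log₂⌈n/2⌉⌉)
  where
  2^k+2^k≤w : 2 ^ k + 2 ^ k ≤ w
  2^k+2^k≤w = subst (_≤ w) (2^[1+k]≡2^k+2^k k) (s≤s⁻¹ 2^[1+k]<1+w)

  -- ⌈ 1 + w /2⌉ reduces to 1 + ⌊ w /2⌋
  k<⌈log₂⌈n/2⌉⌉ : k < ⌈log₂ ⌈ suc w /2⌉ ⌉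
  k<⌈log₂⌈n/2⌉⌉ = 2^k<n⇒k<⌈log₂n⌉ k (s≤s (subst (_≤ ⌊ w /2⌋) (sym (ℕ.n≡⌊n+n/2⌋ (2 ^ k)))
                                                (ℕ.⌊n/2⌋-mono 2^k+2^k≤w)))

  halving : ⌈log₂ ⌈ suc w /2⌉ ⌉ ≡ ⌈log₂ suc w ⌉ ∸ 1
  halving = ⌈log₂⌈n/2⌉⌉≡⌈log₂n⌉∸1 (suc w)

  <∸1⇒suc< : ∀ {x} → k < x ∸ 1 → suc k < x
  <∸1⇒suc< {suc x} k<x = s≤s k<x

⌈log₂⌉-exact : ∀ k {n} → 2 ^ k < n → n ≤ 2 ^ suc k → ⌈log₂ n ⌉ ≡ suc k
⌈log₂⌉-exact k {n} 2^k<n n≤2^[1+k] = ℕ.≤-antisym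
  (subst (⌈log₂ n ⌉ ≤_) (⌈log₂2^n⌉≡n (suc k)) (⌈log₂⌉-mono-≤ n≤2^[1+k]))
  (2^k<n⇒k<⌈log₂n⌉ k 2^k<n)

data Window : ℕ → List ℕ → ℕ → Set where
  single : ∀ a → Window a [] (2 ^ a)
  longer : ∀ a b bs {v} → 2 ^ a < v → v < 2 ^ suc a → Window (suc a) (b ∷ bs) v

Window⇒⌈log₂⌉≡ : ∀ {a as v} → Window a as v → ⌈log₂ v ⌉ ≡ a
Window⇒⌈log₂⌉≡ (single a)                     = ⌈log₂2^n⌉≡n a
Window⇒⌈log₂⌉≡ (longer a _ _ 2^a<v v<2^[1+a]) = ⌈log₂⌉-exact a 2^a<v (ℕ.<⇒≤ v<2^[1+a])

Window⇒0< : ∀ {a as v} → Window a as v → 0 < v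
Window⇒0< (single a)              = ℕ.m^n>0 2 a
Window⇒0< (longer a _ _ 2^a<v _) = ℕ.<-≤-trans (ℕ.m^n>0 2 a) (ℕ.<⇒≤ 2^a<v)

single-longer-disjoint : ∀ {a b bs v} → Window a [] v → Window a (b ∷ bs) v → ⊥
single-longer-disjoint (single _) (longer _ _ _ _ 2^a<2^a) = ℕ.<-irrefl refl 2^a<2^a

longer-window : ∀ a b bs {w} → 0 < w → w < 2 ^ a → Window (suc a) (b ∷ bs) (2 ^ suc a ∸ w)
longer-window a b bs {w} 0<w w<2^a = longer a b bs
  (ℕ.m+n≤o⇒m≤o∸n (suc (2 ^ a)) (subst (suc (2 ^ a) + w ≤_) (sym (2^[1+k]≡2^k+2^k a))
                                        (ℕ.+-monoʳ-< (2 ^ a) w<2^a)))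
  (ℕ.∸-monoʳ-< 0<w (ℕ.<⇒≤ (ℕ.<-≤-trans w<2^a (ℕ.^-monoʳ-≤ 2 (ℕ.n≤1+n a)))))

altSum-∷ : ∀ a as {w} → altSum as ≡ + w → w ≤ 2 ^ a → altSum (a ∷ as) ≡ + (2 ^ a ∸ w)
altSum-∷ a as {w} as≡w w≤2^a = begin
  + 2 ^ a ℤ.- altSum as ≡⟨ cong (λ s → + 2 ^ a ℤ.- s) as≡w ⟩
  + 2 ^ a ℤ.- + w       ≡⟨ ℤ.m-n≡m⊖n (2 ^ a) w ⟩
  2 ^ a ℤ.⊖ w           ≡⟨ ℤ.⊖-≥ w≤2^a ⟩
  + (2 ^ a ∸ w)         ∎
  where open ≡-Reasoning

ABRShape⇒Window : ∀ {a as} → ABRShape (a ∷ as) → Σ[ v ∈ ℕ ] (altSum (a ∷ as) ≡ + v × Window a as v)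
ABRShape⇒Window (one a) = 2 ^ a , cong +_ (ℕ.+-identityʳ (2 ^ a)) , single a
ABRShape⇒Window (two (suc a) b (s≤s 1+b<1+a)) =
  _ , altSum-∷ (suc a) (b ∷ []) (cong +_ (ℕ.+-identityʳ (2 ^ b))) (ℕ.<⇒≤ 2^b<2^[1+a])
    , longer-window a b [] (ℕ.m^n>0 2 b) 2^b<2^a
  where
  2^b<2^a : 2 ^ b < 2 ^ a
  2^b<2^a = ℕ.^-monoʳ-< 2 (s≤s (s≤s z≤n)) 1+b<1+a
  2^b<2^[1+a] : 2 ^ b < 2 ^ suc a
  2^b<2^[1+a] = ℕ.<-≤-trans 2^b<2^a (ℕ.^-monoʳ-≤ 2 (ℕ.n≤1+n a))
ABRShape⇒Window (more (suc a) b c cs (s≤s b≤a) tail) with ABRShape⇒Window tail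
... | w , tail≡w , window@(longer _ _ _ _ w<2^b) =
  _ , altSum-∷ (suc a) (b ∷ c ∷ cs) tail≡w (ℕ.<⇒≤ (ℕ.<-≤-trans w<2^a (ℕ.^-monoʳ-≤ 2 (ℕ.n≤1+n a))))
    , longer-window a b (c ∷ cs) (Window⇒0< window) w<2^a
  where
  w<2^a : w < 2 ^ a
  w<2^a = ℕ.<-≤-trans w<2^b (ℕ.^-monoʳ-≤ 2 b≤a)

ABR⇒Window : ∀ {n a as} → IsABR n (a ∷ as) → Window a as n
ABR⇒Window (shape , α≡n) with ABRShape⇒Window shape
... | v , α≡v , window = subst (Window _ _) (ℤ.+-injective (trans (sym α≡v) α≡n)) window

ABRShape-tail : ∀ {a b bs} → ABRShape (a ∷ b ∷ bs) → ABRShape (b ∷ bs)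
ABRShape-tail (two a b _)          = one b
ABRShape-tail (more a b c cs _ bs) = bs

ABR-tail : ∀ {n a b bs} → IsABR n (a ∷ b ∷ bs) →
  Σ[ m ∈ ℕ ] ((+ m ≡ + 2 ^ a ℤ.- + n) × IsABR m (b ∷ bs))
ABR-tail {n} {a} {b} {bs} (shape , α≡n) with ABRShape⇒Window (ABRShape-tail shape)
... | m , tail≡m , _ = m , m≡2^a-n , ABRShape-tail shape , tail≡m
  where
  open ≡-Reasoning
  y≡x-[x-y] : ∀ x y → y ≡ x ℤ.- (x ℤ.- y)
  y≡x-[x-y] = solve-∀
  m≡2^a-n : + m ≡ + 2 ^ a ℤ.- + n
  m≡2^a-n = begin
    + m                                            ≡⟨ sym tail≡m ⟩
    altSum (b ∷ bs)                                ≡⟨ y≡x-[x-y] (+ 2 ^ a) (altSum (b ∷ bs)) ⟩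
    + 2 ^ a ℤ.- (+ 2 ^ a ℤ.- altSum (b ∷ bs))      ≡⟨ cong (λ s → + 2 ^ a ℤ.- s) α≡n ⟩
    + 2 ^ a ℤ.- + n                                ∎

ABR-unique : ∀ {n} α β → IsABR n α → IsABR n β → β ≡ α
ABR-unique (a ∷ as) (b ∷ bs) α-abr β-abr
  with trans (sym (Window⇒⌈log₂⌉≡ (ABR⇒Window β-abr))) (Window⇒⌈log₂⌉≡ (ABR⇒Window α-abr))
ABR-unique (a ∷ []) (a ∷ []) α-abr β-abr | refl = refl
ABR-unique (a ∷ []) (a ∷ _ ∷ _) α-abr β-abr | refl =
  ⊥-elim (single-longer-disjoint (ABR⇒Window α-abr) (ABR⇒Window β-abr))
ABR-unique (a ∷ _ ∷ _) (a ∷ []) α-abr β-abr | refl =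
  ⊥-elim (single-longer-disjoint (ABR⇒Window β-abr) (ABR⇒Window α-abr))
ABR-unique (a ∷ a′ ∷ as) (a ∷ b′ ∷ bs) α-abr β-abr | refl =
  cong (a ∷_) (ABR-unique (a′ ∷ as) (b′ ∷ bs)
    (proj₂ (proj₂ αs)) (subst (λ k → IsABR k _) m′≡m (proj₂ (proj₂ βs))))
  where
  αs = ABR-tail α-abr
  βs = ABR-tail β-abr
  m′≡m : proj₁ βs ≡ proj₁ αs
  m′≡m = ℤ.+-injective (trans (proj₁ (proj₂ βs)) (sym (proj₁ (proj₂ αs))))

sgn²≡1 : ∀ i → sgn i ℤ.* sgn i ≡ ℤ.1ℤ
sgn²≡1 zero    = refl
sgn²≡1 (suc i) = trans (negate-both (sgn i)) (sgn²≡1 i)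
  where
  negate-both : ∀ s → (ℤ.- ℤ.1ℤ ℤ.* s) ℤ.* (ℤ.- ℤ.1ℤ ℤ.* s) ≡ s ℤ.* s
  negate-both = solve-∀

sumFrom≡altSum-drop : ∀ j k α →
  sumFrom j k α ≡ sgn j ℤ.* (altSum α ℤ.- sgn k ℤ.* altSum (drop k α))
sumFrom≡altSum-drop j zero    α        = base (sgn j) (altSum α)
  where
  base : ∀ s A → ℤ.0ℤ ≡ s ℤ.* (A ℤ.- ℤ.1ℤ ℤ.* A)
  base = solve-∀
sumFrom≡altSum-drop j (suc k) []       = empty (sgn j) (sgn (suc k))
  where
  empty : ∀ s t → ℤ.0ℤ ≡ s ℤ.* (ℤ.0ℤ ℤ.- t ℤ.* ℤ.0ℤ)
  empty = solve-∀
sumFrom≡altSum-drop j (suc k) (a ∷ as) =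
  trans (cong (λ s → sgn j ℤ.* + 2 ^ a ℤ.+ s) (sumFrom≡altSum-drop (suc j) k as))
        (shift (sgn j) (+ 2 ^ a) (altSum as) (sgn k) (altSum (drop k as)))
  where
  shift : ∀ s x S t D →
    s ℤ.* x ℤ.+ (ℤ.- ℤ.1ℤ ℤ.* s) ℤ.* (S ℤ.- t ℤ.* D) ≡ s ℤ.* ((x ℤ.- S) ℤ.- (ℤ.- ℤ.1ℤ ℤ.* t) ℤ.* D)
  shift = solve-∀

signed-residual≡altSum-drop : ∀ {n} α k → altSum α ≡ + n →
  sgn k ℤ.* (+ n ℤ.+ sumFrom 1 k α) ≡ altSum (drop k α)
signed-residual≡altSum-drop {n} α k α≡n = begin
  sgn k ℤ.* (+ n ℤ.+ sumFrom 1 k α)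
    ≡⟨ cong (λ s → sgn k ℤ.* (+ n ℤ.+ s)) (sumFrom≡altSum-drop 1 k α) ⟩
  sgn k ℤ.* (+ n ℤ.+ sgn 1 ℤ.* (altSum α ℤ.- sgn k ℤ.* D))
    ≡⟨ cong (λ s → sgn k ℤ.* (+ n ℤ.+ sgn 1 ℤ.* (s ℤ.- sgn k ℤ.* D))) α≡n ⟩
  sgn k ℤ.* (+ n ℤ.+ sgn 1 ℤ.* (+ n ℤ.- sgn k ℤ.* D))
    ≡⟨ cancel (+ n) (sgn k) D ⟩
  (sgn k ℤ.* sgn k) ℤ.* D
    ≡⟨ cong (ℤ._* D) (sgn²≡1 k) ⟩
  ℤ.1ℤ ℤ.* D
    ≡⟨ ℤ.*-identityˡ D ⟩
  D ∎
  where
  open ≡-Reasoning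
  D = altSum (drop k α)
  cancel : ∀ x t D → t ℤ.* (x ℤ.+ (ℤ.- ℤ.1ℤ ℤ.* ℤ.1ℤ) ℤ.* (x ℤ.- t ℤ.* D)) ≡ (t ℤ.* t) ℤ.* D
  cancel = solve-∀

drop≡lookup∷drop : ∀ {A : Set} (xs : List A) (i : Fin (length xs)) →
  drop (toℕ i) xs ≡ lookup xs i ∷ drop (suc (toℕ i)) xs
drop≡lookup∷drop (x ∷ xs) zero    = refl
drop≡lookup∷drop (x ∷ xs) (suc i) = drop≡lookup∷drop xs i

ABRShape-suffix : ∀ α (i : Fin (length α)) → ABRShape α →
  ABRShape (lookup α i ∷ drop (suc (toℕ i)) α)
ABRShape-suffix (a ∷ as)     zero    shape = shape
ABRShape-suffix (a ∷ b ∷ bs) (suc i) shape = ABRShape-suffix (b ∷ bs) i (ABRShape-tail shape)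

ABR-exponent : ∀ {n} α → IsABR n α → (i : Fin (length α)) →
  Σ[ m ∈ ℕ ] (0 < m
    × sgn (toℕ i) ℤ.* ((+ n) ℤ.+ sumFrom 1 (toℕ i) α) ≡ + m
    × lookup α i ≡ ⌈log₂ m ⌉)
ABR-exponent α (shape , α≡n) i with ABRShape⇒Window (ABRShape-suffix α i shape)
... | m , suffix≡m , window =
  m , Window⇒0< window
    , trans (signed-residual≡altSum-drop α (toℕ i) α≡n)
            (trans (cong altSum (drop≡lookup∷drop α i)) suffix≡m)
    , sym (Window⇒⌈log₂⌉≡ window)

lemma19 : (n : ℕ) (α : List ℕ) → IsABR n α →
    (head α ≡ just ⌈log₂ n ⌉)
    × ((i : Fin (length α)) → 1 ≤ toℕ i →
        Σ[ m ∈ ℕ ] (0 < m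
          × sgn (toℕ i) ℤ.* ((+ n) ℤ.+ sumFrom 1 (toℕ i) α) ≡ + m
          × lookup α i ≡ ⌈log₂ m ⌉))
    × ((β : List ℕ) → IsABR n β → β ≡ α)
    × ((a : ℕ) (β : List ℕ) → α ≡ a ∷ β → β ≢ [] →
        Σ[ m ∈ ℕ ] ((+ m ≡ (+ (2 ^ a)) ℤ.- (+ n)) × IsABR m β))
lemma19 n α@(_ ∷ _) abr =
  cong just (sym (Window⇒⌈log₂⌉≡ (ABR⇒Window abr))) ,
  (λ i _ → ABR-exponent α abr i) ,
  (λ β β-abr → ABR-unique α β abr β-abr) ,
  tail-ABR
  where
  tail-ABR : (a′ : ℕ) (β : List ℕ) → α ≡ a′ ∷ β → β ≢ [] →
    Σ[ m ∈ ℕ ] ((+ m ≡ (+ (2 ^ a′)) ℤ.- (+ n)) × IsABR m β)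
  tail-ABR _ []      refl β≢[] = ⊥-elim (β≢[] refl)
  tail-ABR _ (_ ∷ _) refl _    = ABR-tail abr
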